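{- (i) The rule "from $\neg(A\land B)$ infer $\neg(\Box A\land\Diamond B)$" is derivable in $\mathsf{WM}$. (ii) The rule "from $A$ infer $\Box A$" is derivable in $\mathsf{WMN}$. (iii) $\mathsf{WMN}\vdash\neg\Diamond\bot$. (iv) $\mathsf{WMC}\vdash\Box(A\to B)\to(\Box A\to\Box B)$ for all $A,B$. (v) $\mathsf{WMP}\vdash\neg\Box\bot$. (vi) $\mathsf{WMND}\vdash\Diamond\top$.
   Context: The language $\mathcal{L}$ consists of the formulas built from a countable set of propositional variables by $A ::= p \mid \bot \mid A\land A \mid A\lor A \mid A\to A \mid \Box A \mid \Diamond A$; $\top := \bot\to\bot$, $\neg A := A\to\bot$. Axiom schemes and rules (for all $A,B$): (Mon$_\Box$) from $A\to B$ infer $\Box A\to\Box B$; (Mon$_\Diamond$) from $A\to B$ infer $\Diamond A\to\Diamond B$; (C$_\Box$) $\Box A\land\Box B\to\Box(A\land B)$; (K$_\Diamond$) $\Box(A\to B)\to(\Diamond A\to\Diamond B)$; (N$_\Box$) $\Box\top$; (D) $\Box A\to\Diamond A$; (P$_\Diamond$) $\Diamond\top$; (Dual$_\land$) $\neg(\Box A\land\Diamond\neg A)$. Over an axiomatisation of intuitionistic propositional logic (all $\mathcal L$-instances, with modus ponens): $\mathsf{WM}$ := Dual$_\land$ + Mon$_\Box$ + Mon$_\Diamond$; $\mathsf{WMN}$ := $\mathsf{WM}$ + N$_\Box$; $\mathsf{WMC}$ := $\mathsf{WM}$ + C$_\Box$ + K$_\Diamond$; $\mathsf{WMP}$ :=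 $\mathsf{WM}$ + P$_\Diamond$; $\mathsf{WMND}$ := $\mathsf{WMN}$ + D. $\mathsf{L}\vdash A$ means $A$ is derivable from axiom instances of $\mathsf{L}$ by modus ponens and the rules of $\mathsf{L}$; a rule is derivable in $\mathsf{L}$ if its conclusion can be derived in $\mathsf L$ from its premiss using the axioms and rules of $\mathsf L$. -}

module Defs where

open import Data.Nat using (ℕ)
open import Data.Bool using (Bool; true; false)
open import Data.List using (List; []; _∷_)
open import Data.List.Membership.Propositional using (_∈_)
open import Relation.Binary.PropositionalEquality using (_≡_)

infixr 6 _∧'_
infixr 5 _∨'_
infixr 4 _⇒_

data Fm : Set where
  var  : ℕ → Fm
  ⊥'   : Fm
  _∧'_ : Fm → Fm → Fm
  _∨'_ : Fm → Fm → Fm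
  _⇒_  : Fm → Fm → Fm
  □    : Fm → Fm
  ◇    : Fm → Fm

⊤' : Fm
⊤' = ⊥' ⇒ ⊥'

¬' : Fm → Fm
¬' A = A ⇒ ⊥'

-- Which optional axioms are present in a logic over WM
-- (Dual∧, Mon□, Mon◇ are always present).
record Logic : Set where
  field
    hasN□ : Bool
    hasC□ : Bool
    hasK◇ : Bool
    hasD  : Bool
    hasP◇ : Bool
open Logic public

WM WMN WMC WMP WMND : Logic
WM   = record { hasN□ = false ; hasC□ = false ; hasK◇ = false ; hasD = false ; hasP◇ = false }
WMN  = record { hasN□ = true  ; hasC□ = false ; hasK◇ = false ; hasD = false ; hasP◇ = false }
WMC  = record { hasN□ = false ; hasC□ = true  ; hasK◇ = true  ; hasD = false ; hasP◇ = false }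
WMP  = record { hasN□ = false ; hasC□ = false ; hasK◇ = false ; hasD = false ; hasP◇ = true  }
WMND = record { hasN□ = true  ; hasC□ = false ; hasK◇ = false ; hasD = true  ; hasP◇ = false }

-- Derivability in L from a list of premisses Γ: Hilbert-style, with a standard
-- axiomatisation of intuitionistic propositional logic, modus ponens, the
-- modal rules (which may be applied to anything derived, including premisses),
-- and the modal axioms selected by L.
data _⊢[_]_ (L : Logic) (Γ : List Fm) : Fm → Set where
  hyp   : ∀ {A} → A ∈ Γ → L ⊢[ Γ ] A
  ax-K  : ∀ {A B} → L ⊢[ Γ ] (A ⇒ B ⇒ A)
  ax-S  : ∀ {A B C} → L ⊢[ Γ ] ((A ⇒ B ⇒ C) ⇒ (A ⇒ B) ⇒ A ⇒ C)
  ax-∧E₁ : ∀ {A B} → L ⊢[ Γ ] (A ∧' B ⇒ A)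
  ax-∧E₂ : ∀ {A B} → L ⊢[ Γ ] (A ∧' B ⇒ B)
  ax-∧I  : ∀ {A B} → L ⊢[ Γ ] (A ⇒ B ⇒ A ∧' B)
  ax-∨I₁ : ∀ {A B} → L ⊢[ Γ ] (A ⇒ A ∨' B)
  ax-∨I₂ : ∀ {A B} → L ⊢[ Γ ] (B ⇒ A ∨' B)
  ax-∨E  : ∀ {A B C} → L ⊢[ Γ ] ((A ⇒ C) ⇒ (B ⇒ C) ⇒ A ∨' B ⇒ C)
  ax-⊥E  : ∀ {A} → L ⊢[ Γ ] (⊥' ⇒ A)
  mp    : ∀ {A B} → L ⊢[ Γ ] (A ⇒ B) → L ⊢[ Γ ] A → L ⊢[ Γ ] B
  dual∧ : ∀ {A} → L ⊢[ Γ ] ¬' (□ A ∧' ◇ (¬' A))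
  mon□  : ∀ {A B} → L ⊢[ Γ ] (A ⇒ B) → L ⊢[ Γ ] (□ A ⇒ □ B)
  mon◇  : ∀ {A B} → L ⊢[ Γ ] (A ⇒ B) → L ⊢[ Γ ] (◇ A ⇒ ◇ B)
  n□    : hasN□ L ≡ true → L ⊢[ Γ ] □ ⊤'
  c□    : ∀ {A B} → hasC□ L ≡ true → L ⊢[ Γ ] (□ A ∧' □ B ⇒ □ (A ∧' B))
  k◇    : ∀ {A B} → hasK◇ L ≡ true → L ⊢[ Γ ] (□ (A ⇒ B) ⇒ ◇ A ⇒ ◇ B)
  d     : ∀ {A} → hasD L ≡ true → L ⊢[ Γ ] (□ A ⇒ ◇ A)
  p◇    : hasP◇ L ≡ true → L ⊢[ Γ ] ◇ ⊤'

_⊢_ : Logic → Fm → Set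
L ⊢ A = L ⊢[ [] ] A

DerivableRule : Logic → Fm → Fm → Set
DerivableRule L P C = L ⊢[ P ∷ [] ] C

-- The rule (i) is Dual∧ at ¬B, reached from □A by Mon□ applied to A → ¬B and from
-- ◇B by Mon◇ applied to B → ¬¬B. Instantiating it at ⊤ ∧ ⊥ and at ⊥ ∧ ⊤ gives
-- ¬(□⊤ ∧ ◇⊥) and ¬(□⊥ ∧ ◇⊤), whence (iii) from N□ and (v) from P◇.
module Submission where

open import Defs
open import Data.Bool using (true)
open import Data.List using (List)
open import Data.List.Relation.Unary.Any using (here)
open import Data.Product using (_×_; _,_)
open import Relation.Binary.PropositionalEquality using (_≡_; refl)

module _ {L : Logic} {Γ : List Fm} where

  ⇒-const : ∀ {A B} → L ⊢[ Γ ] B → L ⊢[ Γ ] (A ⇒ B)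
  ⇒-const = mp ax-K

  ⇒-mp : ∀ {A B C} → L ⊢[ Γ ] (A ⇒ B ⇒ C) → L ⊢[ Γ ] (A ⇒ B) → L ⊢[ Γ ] (A ⇒ C)
  ⇒-mp f g = mp (mp ax-S f) g

  ⇒-refl : ∀ {A} → L ⊢[ Γ ] (A ⇒ A)
  ⇒-refl {A} = ⇒-mp ax-K (ax-K {B = A})

  ⇒-trans : ∀ {A B C} → L ⊢[ Γ ] (A ⇒ B) → L ⊢[ Γ ] (B ⇒ C) → L ⊢[ Γ ] (A ⇒ C)
  ⇒-trans f g = ⇒-mp (⇒-const g) f

  ⇒-flip : ∀ {A B C} → L ⊢[ Γ ] (A ⇒ B ⇒ C) → L ⊢[ Γ ] (B ⇒ A ⇒ C)
  ⇒-flip f = ⇒-trans ax-K (mp ax-S f)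

  ¬¬-intro : ∀ {A} → L ⊢[ Γ ] (A ⇒ ¬' (¬' A))
  ¬¬-intro = ⇒-flip ⇒-refl

  ⟨_,_⟩ : ∀ {A B C} → L ⊢[ Γ ] (A ⇒ B) → L ⊢[ Γ ] (A ⇒ C) → L ⊢[ Γ ] (A ⇒ B ∧' C)
  ⟨ f , g ⟩ = ⇒-mp (⇒-mp (⇒-const ax-∧I) f) g

  ∧-map : ∀ {A B C D} → L ⊢[ Γ ] (A ⇒ B) → L ⊢[ Γ ] (C ⇒ D) → L ⊢[ Γ ] (A ∧' C ⇒ B ∧' D)
  ∧-map f g = ⟨ ⇒-trans ax-∧E₁ f , ⇒-trans ax-∧E₂ g ⟩

  ∧-apply : ∀ {A B} → L ⊢[ Γ ] ((A ⇒ B) ∧' A ⇒ B)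
  ∧-apply = ⇒-mp ax-∧E₁ ax-∧E₂

  ⇒-curry : ∀ {A B C} → L ⊢[ Γ ] (A ∧' B ⇒ C) → L ⊢[ Γ ] (A ⇒ B ⇒ C)
  ⇒-curry g = ⇒-trans ax-∧I (mp ax-S (⇒-const g))

  ¬∧-elimˡ : ∀ {A B} → L ⊢[ Γ ] ¬' (A ∧' B) → L ⊢[ Γ ] A → L ⊢[ Γ ] ¬' B
  ¬∧-elimˡ h a = ⇒-trans ⟨ ⇒-const a , ⇒-refl ⟩ h

  ¬∧-elimʳ : ∀ {A B} → L ⊢[ Γ ] ¬' (A ∧' B) → L ⊢[ Γ ] B → L ⊢[ Γ ] ¬' A
  ¬∧-elimʳ h b = ⇒-trans ⟨ ⇒-refl , ⇒-const b ⟩ h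

  dual-rule : ∀ {A B} → L ⊢[ Γ ] ¬' (A ∧' B) → L ⊢[ Γ ] ¬' (□ A ∧' ◇ B)
  dual-rule h = ⇒-trans (∧-map (mon□ (⇒-curry h)) (mon◇ ¬¬-intro)) dual∧

  necessitation : hasN□ L ≡ true → ∀ {A} → L ⊢[ Γ ] A → L ⊢[ Γ ] □ A
  necessitation N a = mp (mon□ (⇒-const a)) (n□ N)

  ¬◇⊥ : hasN□ L ≡ true → L ⊢[ Γ ] ¬' (◇ ⊥')
  ¬◇⊥ N = ¬∧-elimˡ (dual-rule ax-∧E₂) (n□ N)

  □-K : hasC□ L ≡ true → ∀ {A B} → L ⊢[ Γ ] (□ (A ⇒ B) ⇒ □ A ⇒ □ B)
  □-K C = ⇒-curry (⇒-trans (c□ C) (mon□ ∧-apply))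

  ¬□⊥ : hasP◇ L ≡ true → L ⊢[ Γ ] ¬' (□ ⊥')
  ¬□⊥ P = ¬∧-elimʳ (dual-rule ax-∧E₁) (p◇ P)

  ◇⊤ : hasN□ L ≡ true → hasD L ≡ true → L ⊢[ Γ ] ◇ ⊤'
  ◇⊤ N D = mp (d D) (n□ N)

proposition3p3 :
    ((A B : Fm) → DerivableRule WM (¬' (A ∧' B)) (¬' (□ A ∧' ◇ B)))
    × ((A : Fm) → DerivableRule WMN A (□ A))
    × (WMN ⊢ ¬' (◇ ⊥'))
    × ((A B : Fm) → WMC ⊢ (□ (A ⇒ B) ⇒ □ A ⇒ □ B))
    × (WMP ⊢ ¬' (□ ⊥'))
    × (WMND ⊢ ◇ ⊤')
proposition3p3 =
    (λ A B → dual-rule (hyp (here refl)))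
  , (λ A → necessitation refl (hyp (here refl)))
  , ¬◇⊥ refl
  , (λ A B → □-K refl)
  , ¬□⊥ refl
  , ◇⊤ refl refl
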